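{- Let $K$ be a field of characteristic zero and let $\{b_i\}_{i\ge0}$, $\{u_i\}_{i\ge0}$ be sequences in $K$ satisfying $$e^{ -u_0X}\,e^{u_0X+\sum_{k\ge0}u_{k+1}(\mathrm{ad}X)^k(Y)}\equiv e^{b_0X+\sum_{k\ge0}b_{k+1}(\mathrm{ad}X)^k(Y)}\mod I_Y$$ in the noncommutative power series ring $K\langle\langle X,Y\rangle\rangle$. Then $b_0=0$ and, for $k=1,2,\dots$, $$b_k=\sum_{i=1}^k\frac{(-u_0)^{k-i}}{(k+1-i)!}u_i,\qquad u_k=\sum_{s=0}^{k-1}\frac{B_s}{s!}(-u_0)^s b_{k-s}.$$
   Context: $I_Y$ is the (closed two-sided) ideal of $K\langle\langle X,Y\rangle\rangle$ generated by monomials containing $Y$ at least twice; $(\mathrm{ad}X)(Z)=XZ-ZX$. $B_s$ are the Bernoulli numbers defined by $\sum_{s\ge0}\frac{B_s}{s!}T^s=\frac{T}{e^T-1}$. -}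

module Defs where

open import Level using (Level; _⊔_)
open import Algebra.Bundles using (CommutativeRing)
open import Data.Nat as ℕ using (ℕ; zero; suc; _≤_)
open import Data.Nat.Base using (_!)
open import Data.Bool using (Bool; true; false)
import Data.List
open import Data.List using (List; []; _∷_; length)
open import Data.Product using (_×_; _,_)
open import Relation.Nullary using (¬_)

record Field (c ℓ : Level) : Set (Level.suc (c ⊔ ℓ)) where
  field
    commutativeRing : CommutativeRing c ℓ
  open CommutativeRing commutativeRing public
  field
    _⁻¹      : Carrier → Carrier
    ⁻¹-inverse : ∀ x → ¬ (x ≈ 0#) → x * (x ⁻¹) ≈ 1#
    1≉0      : ¬ (1# ≈ 0#)

module FieldTheory {c ℓ : Level} (K : Field c ℓ) where
  open Field K using (Carrier; _≈_; _+_; _*_; _-_; -_; 0#; 1#; _⁻¹)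

  fromℕ : ℕ → Carrier
  fromℕ zero    = 0#
  fromℕ (suc n) = 1# + fromℕ n

  CharacteristicZero : Set ℓ
  CharacteristicZero = ∀ n → ¬ (fromℕ (suc n) ≈ 0#)

  infixr 8 _^_
  _^_ : Carrier → ℕ → Carrier
  x ^ zero  = 1#
  x ^ suc n = x * (x ^ n)

  invFact : ℕ → Carrier
  invFact n = (fromℕ (n !)) ⁻¹

  Σ< : ℕ → (ℕ → Carrier) → Carrier
  Σ< zero    f = 0#
  Σ< (suc n) f = Σ< n f + f n

  -- Σ_{i = a}^{b} f i   (empty if b < a)
  Σ[_⋯_] : ℕ → ℕ → (ℕ → Carrier) → Carrier
  Σ[ a ⋯ b ] f = Σ< (suc b ℕ.∸ a) (λ j → f (a ℕ.+ j))

  -- Bernoulli numbers in K, as the coefficients of T/(e^T - 1):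
  -- (Σ_s B_s/s! T^s) · (e^T - 1) = T, i.e. for all n,
  -- Σ_{s+t=n, t ≥ 1} (B_s/s!)(1/t!) = [n = 1].
  delta1 : ℕ → Carrier
  delta1 (suc zero) = 1#
  delta1 _          = 0#

  IsBernoulli : (ℕ → Carrier) → Set ℓ
  IsBernoulli B = ∀ n →
    Σ< n (λ s → (B s * invFact s) * invFact (n ℕ.∸ s)) ≈ delta1 n

  -- Noncommutative formal power series K⟨⟨X,Y⟩⟩ :
  -- a series is its coefficient function on words; letter false = X,
  -- letter true = Y.
  Word : Set
  Word = List Bool

  Series : Set c
  Series = Word → Carrier

  splits : Word → List (Word × Word)
  splits []      = ([] , []) ∷ []
  splits (a ∷ w) = ([] , a ∷ w) ∷ Data.List.map (λ { (u , v) → (a ∷ u , v) }) (splits w)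

  sumList : List Carrier → Carrier
  sumList []       = 0#
  sumList (x ∷ xs) = x + sumList xs

  oneS : Series
  oneS [] = 1#
  oneS (_ ∷ _) = 0#

  Xs : Series
  Xs (false ∷ []) = 1#
  Xs _            = 0#

  Ys : Series
  Ys (true ∷ []) = 1#
  Ys _           = 0#

  _+S_ : Series → Series → Series
  (f +S g) w = f w + g w

  _-S_ : Series → Series → Series
  (f -S g) w = f w - g w

  _·S_ : Carrier → Series → Series
  (a ·S f) w = a * f w

  _*S_ : Series → Series → Series
  (f *S g) w = sumList (Data.List.map (λ { (u , v) → f u * g v }) (splits w))

  powS : Series → ℕ → Series
  powS f zero    = oneS
  powS f (suc n) = f *S powS f n

  -- Since f has zero constant term, f^n has no terms of degree < n, so the
  -- coefficient of a word w only receives contributions from n ≤ |w|.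
  expS : Series → Series
  expS f w = Σ< (suc (length w)) (λ n → invFact n * powS f n w)

  adX : Series → Series
  adX f = (Xs *S f) -S (f *S Xs)

  adX^ : ℕ → Series → Series
  adX^ zero    f = f
  adX^ (suc k) f = adX (adX^ k f)

  -- a X + Σ_{k≥0} c_{k+1} (ad X)^k (Y); (ad X)^k(Y) is homogeneous of
  -- degree k+1, so only k < |w| contributes to the coefficient of w.
  genSeries : Carrier → (ℕ → Carrier) → Series
  genSeries a c w = a * Xs w + Σ< (length w) (λ k → c (suc k) * adX^ k Ys w)

  countY : Word → ℕ
  countY []          = zero
  countY (true ∷ w)  = suc (countY w)
  countY (false ∷ w) = countY w

  -- congruence modulo I_Y: the closed ideal generated by monomials with
  -- at least two Y's consists exactly of the series supported on such
  -- words, so f ≡ g mod I_Y iff their coefficients agree on all words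
  -- with at most one Y.
  _≡S_modIY : Series → Series → Set ℓ
  f ≡S g modIY = ∀ w → countY w ≤ 1 → f w ≈ g w

{-# OPTIONS --safe #-}
-- Modulo I_Y only the coefficients at the words Xⁿ and XⁿY matter, and along these words a
-- product of series becomes a Cauchy product of coefficient sequences, i.e. of power series
-- in one variable T.  As (ad X)ᵏ(Y) has coefficient δₖₙ at XⁿY, the exponential of
-- aX + Σₖ cₖ₊₁ (ad X)ᵏ(Y) has coefficient aⁿ/n! at Xⁿ and ((e^{aT} - 1)/(aT) ⋆ c₊)ₙ at XⁿY,
-- where c₊ = (c₁, c₂, …).  Comparing both sides of the hypothesis at X gives b₀ = 0, and
-- at XⁿY gives
--   b₊ = e^{-u₀T} (e^{u₀T} - 1)/(u₀T) ⋆ u₊ = (e^{-u₀T} - 1)/(-u₀T) ⋆ u₊,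
-- which is the first formula; the second inverts it with the Bernoulli series
-- (-u₀T)/(e^{-u₀T} - 1).  Characteristic zero makes the 1/n! exist and lets e^{-T} e^{T} = 1
-- follow from the vanishing of its derivative.
module Submission where

open import Defs
open import Level using (Level)
open import Algebra.Bundles using (CommutativeRing)
open import Data.Nat using (ℕ; zero; suc; _∸_; _≤_; _<_; z≤n; s≤s)
open import Function using (_∘_; const)

module CauchyProduct {c ℓ : Level} (R : CommutativeRing c ℓ) where
  open CommutativeRing R
  open import Algebra.Properties.Semiring.Mult semiring using (_×_; ×-comm-*)
  open import Algebra.Properties.CommutativeMonoid.Mult +-commutativeMonoid using (×-distrib-+)
  open import Algebra.Properties.Semiring.Exp semiring using (_^_)
  open import Algebra.Properties.CommutativeSemigroup +-commutativeSemigroup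
    using (x∙yz≈y∙xz) renaming (interchange to +-interchange)
  open import Algebra.Properties.CommutativeSemigroup *-commutativeSemigroup
    using () renaming (x∙yz≈y∙xz to x*yz≈y*xz)
  open import Relation.Binary.Reasoning.Setoid setoid

  infix 4 _≋_
  _≋_ : (ℕ → Carrier) → (ℕ → Carrier) → Set ℓ
  f ≋ g = ∀ n → f n ≈ g n

  infixl 7 _⋆_
  _⋆_ : (ℕ → Carrier) → (ℕ → Carrier) → ℕ → Carrier
  (f ⋆ g) zero    = f 0 * g 0
  (f ⋆ g) (suc n) = f 0 * g (suc n) + ((f ∘ suc) ⋆ g) n

  δ : ℕ → ℕ → Carrier
  δ zero    zero    = 1#
  δ zero    (suc n) = 0#
  δ (suc m) zero    = 0#
  δ (suc m) (suc n) = δ m n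

  δ-< : ∀ {m n} → m < n → δ m n ≈ 0#
  δ-< {zero}  {suc n} _         = refl
  δ-< {suc m} {suc n} (s≤s m<n) = δ-< m<n

  ⋆-cong : ∀ {f f′ g g′} → f ≋ f′ → g ≋ g′ → f ⋆ g ≋ f′ ⋆ g′
  ⋆-cong f≋f′ g≋g′ zero    = *-cong (f≋f′ 0) (g≋g′ 0)
  ⋆-cong f≋f′ g≋g′ (suc n) =
    +-cong (*-cong (f≋f′ 0) (g≋g′ (suc n))) (⋆-cong (f≋f′ ∘ suc) g≋g′ n)

  ⋆-zeroˡ : ∀ {f} g → f ≋ const 0# → f ⋆ g ≋ const 0#
  ⋆-zeroˡ g f≋0 zero    = trans (*-congʳ (f≋0 0)) (zeroˡ _)
  ⋆-zeroˡ g f≋0 (suc n) =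
    trans (+-cong (trans (*-congʳ (f≋0 0)) (zeroˡ _)) (⋆-zeroˡ g (f≋0 ∘ suc) n))
          (+-identityʳ 0#)

  ⋆-zeroʳ : ∀ f {g} → g ≋ const 0# → f ⋆ g ≋ const 0#
  ⋆-zeroʳ f g≋0 zero    = trans (*-congˡ (g≋0 0)) (zeroʳ _)
  ⋆-zeroʳ f g≋0 (suc n) =
    trans (+-cong (trans (*-congˡ (g≋0 (suc n))) (zeroʳ _)) (⋆-zeroʳ (f ∘ suc) g≋0 n))
          (+-identityʳ 0#)

  ⋆-scaleˡ : ∀ x f g → (λ j → x * f j) ⋆ g ≋ (λ n → x * (f ⋆ g) n)
  ⋆-scaleˡ x f g zero    = *-assoc x (f 0) (g 0)
  ⋆-scaleˡ x f g (suc n) =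
    trans (+-cong (*-assoc x (f 0) (g (suc n))) (⋆-scaleˡ x (f ∘ suc) g n))
          (sym (distribˡ x _ _))

  ⋆-distribʳ : ∀ f h g → (λ j → f j + h j) ⋆ g ≋ (λ n → (f ⋆ g) n + (h ⋆ g) n)
  ⋆-distribʳ f h g zero    = distribʳ (g 0) (f 0) (h 0)
  ⋆-distribʳ f h g (suc n) = begin
    (f 0 + h 0) * g (suc n) + ((λ j → f (suc j) + h (suc j)) ⋆ g) n
      ≈⟨ +-cong (distribʳ (g (suc n)) (f 0) (h 0)) (⋆-distribʳ (f ∘ suc) (h ∘ suc) g n) ⟩
    (f 0 * g (suc n) + h 0 * g (suc n)) + (((f ∘ suc) ⋆ g) n + ((h ∘ suc) ⋆ g) n)
      ≈⟨ +-interchange _ _ _ _ ⟩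
    (f ⋆ g) (suc n) + (h ⋆ g) (suc n) ∎

  ⋆-snoc : ∀ f g n → (f ⋆ g) (suc n) ≈ (f ⋆ (g ∘ suc)) n + f (suc n) * g 0
  ⋆-snoc f g zero    = refl
  ⋆-snoc f g (suc n) = trans (+-congˡ (⋆-snoc (f ∘ suc) g n)) (sym (+-assoc _ _ _))

  ⋆-assoc : ∀ f g h → f ⋆ (g ⋆ h) ≋ (f ⋆ g) ⋆ h
  ⋆-assoc f g h zero    = sym (*-assoc _ _ _)
  ⋆-assoc f g h (suc n) = begin
    f 0 * (g 0 * h (suc n) + ((g ∘ suc) ⋆ h) n) + ((f ∘ suc) ⋆ (g ⋆ h)) n
      ≈⟨ +-cong (distribˡ (f 0) _ _) (⋆-assoc (f ∘ suc) g h n) ⟩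
    (f 0 * (g 0 * h (suc n)) + f 0 * ((g ∘ suc) ⋆ h) n) + (((f ∘ suc) ⋆ g) ⋆ h) n
      ≈⟨ +-assoc _ _ _ ⟩
    f 0 * (g 0 * h (suc n)) + (f 0 * ((g ∘ suc) ⋆ h) n + (((f ∘ suc) ⋆ g) ⋆ h) n)
      ≈⟨ +-cong (*-assoc _ _ _) (+-congʳ (⋆-scaleˡ (f 0) (g ∘ suc) h n)) ⟨
    (f 0 * g 0) * h (suc n) + (((λ j → f 0 * g (suc j)) ⋆ h) n + (((f ∘ suc) ⋆ g) ⋆ h) n)
      ≈⟨ +-congˡ (⋆-distribʳ (λ j → f 0 * g (suc j)) ((f ∘ suc) ⋆ g) h n) ⟨
    ((f ⋆ g) ⋆ h) (suc n) ∎

  ⋆-rescale : ∀ x f g → (λ j → f j * x ^ j) ⋆ (λ j → g j * x ^ j) ≋ (λ n → (f ⋆ g) n * x ^ n)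
  ⋆-rescale x f g zero    = trans (*-cong (*-identityʳ _) (*-identityʳ _)) (sym (*-identityʳ _))
  ⋆-rescale x f g (suc n) = begin
    (f 0 * 1#) * (g (suc n) * x ^ suc n) + ((λ j → f (suc j) * (x * x ^ j)) ⋆ G) n
      ≈⟨ +-cong (trans (*-congʳ (*-identityʳ _)) (sym (*-assoc _ _ _)))
                (⋆-cong (λ j → x*yz≈y*xz (f (suc j)) x (x ^ j)) (λ _ → refl) n) ⟩
    (f 0 * g (suc n)) * x ^ suc n + ((λ j → x * (f (suc j) * x ^ j)) ⋆ G) n
      ≈⟨ +-congˡ (⋆-scaleˡ x _ G n) ⟩
    (f 0 * g (suc n)) * x ^ suc n + x * ((λ j → f (suc j) * x ^ j) ⋆ G) n
      ≈⟨ +-congˡ (*-congˡ (⋆-rescale x (f ∘ suc) g n)) ⟩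
    (f 0 * g (suc n)) * x ^ suc n + x * (((f ∘ suc) ⋆ g) n * x ^ n)
      ≈⟨ +-congˡ (x*yz≈y*xz x _ _) ⟩
    (f 0 * g (suc n)) * x ^ suc n + ((f ∘ suc) ⋆ g) n * x ^ suc n
      ≈⟨ distribʳ _ _ _ ⟨
    (f ⋆ g) (suc n) * x ^ suc n ∎
    where
    G : ℕ → Carrier
    G j = g j * x ^ j

  δ-⋆ : ∀ g {m n} → m ≤ n → (δ m ⋆ g) n ≈ g (n ∸ m)
  δ-⋆ g {zero}  {zero}  _         = *-identityˡ _
  δ-⋆ g {zero}  {suc n} _         =
    trans (+-cong (*-identityˡ _) (⋆-zeroˡ g (λ _ → refl) n)) (+-identityʳ _)
  δ-⋆ g {suc m} {suc n} (s≤s m≤n) =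
    trans (+-congʳ (zeroˡ _)) (trans (+-identityˡ _) (δ-⋆ g m≤n))

  ϑ : (ℕ → Carrier) → ℕ → Carrier
  ϑ f n = n × f n

  ϑ-⋆ : ∀ f g → ϑ (f ⋆ g) ≋ (λ n → (ϑ f ⋆ g) n + (f ⋆ ϑ g) n)
  ϑ-⋆ f g zero    = sym (trans (+-cong (zeroˡ _) (zeroʳ _)) (+-identityʳ 0#))
  ϑ-⋆ f g (suc n) = begin
    suc n × (f 0 * g (suc n) + (f′ ⋆ g) n)
      ≈⟨ ×-distrib-+ _ _ (suc n) ⟩
    suc n × (f 0 * g (suc n)) + ((f′ ⋆ g) n + ϑ (f′ ⋆ g) n)
      ≈⟨ +-cong (sym (×-comm-* (suc n) (f 0) (g (suc n)))) (+-congˡ (ϑ-⋆ f′ g n)) ⟩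
    f 0 * ϑ g (suc n) + ((f′ ⋆ g) n + ((ϑ f′ ⋆ g) n + (f′ ⋆ ϑ g) n))
      ≈⟨ +-congˡ (+-assoc _ _ _) ⟨
    f 0 * ϑ g (suc n) + (((f′ ⋆ g) n + (ϑ f′ ⋆ g) n) + (f′ ⋆ ϑ g) n)
      ≈⟨ x∙yz≈y∙xz _ _ _ ⟩
    ((f′ ⋆ g) n + (ϑ f′ ⋆ g) n) + (f 0 * ϑ g (suc n) + (f′ ⋆ ϑ g) n)
      -- ϑ f (suc j) is definitionally f′ j + ϑ f′ j
      ≈⟨ +-congʳ (⋆-distribʳ f′ (ϑ f′) g n) ⟨
    ((ϑ f ∘ suc) ⋆ g) n + (f ⋆ ϑ g) (suc n)
      ≈⟨ +-congʳ (trans (+-congʳ (zeroˡ _)) (+-identityˡ _)) ⟨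
    (ϑ f ⋆ g) (suc n) + (f ⋆ ϑ g) (suc n) ∎
    where
    f′ : ℕ → Carrier
    f′ = f ∘ suc

  ∂ : (ℕ → Carrier) → ℕ → Carrier
  ∂ f = ϑ f ∘ suc

  ∂-⋆ : ∀ f g → ∂ (f ⋆ g) ≋ (λ n → (∂ f ⋆ g) n + (f ⋆ ∂ g) n)
  ∂-⋆ f g n = begin
    ϑ (f ⋆ g) (suc n)
      ≈⟨ ϑ-⋆ f g (suc n) ⟩
    (0# * g (suc n) + (∂ f ⋆ g) n) + (f ⋆ ϑ g) (suc n)
      ≈⟨ +-cong (+-congʳ (zeroˡ _)) (⋆-snoc f (ϑ g) n) ⟩
    (0# + (∂ f ⋆ g) n) + ((f ⋆ ∂ g) n + f (suc n) * 0#)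
      ≈⟨ +-cong (+-identityˡ _) (trans (+-congˡ (zeroʳ _)) (+-identityʳ _)) ⟩
    (∂ f ⋆ g) n + (f ⋆ ∂ g) n ∎

module FieldProperties {c ℓ : Level} (K : Field c ℓ) where
  open Field K
  open FieldTheory K using (fromℕ)
  open import Algebra.Properties.Semiring.Mult semiring using (_×_; ×-congʳ; ×-assoc-*)
  open import Relation.Nullary using (¬_)
  open import Relation.Binary.Reasoning.Setoid setoid

  fromℕ≈×1# : ∀ n → fromℕ n ≈ n × 1#
  fromℕ≈×1# zero    = refl
  fromℕ≈×1# (suc n) = +-congˡ (fromℕ≈×1# n)

  ×≈fromℕ* : ∀ n x → n × x ≈ fromℕ n * x
  ×≈fromℕ* n x = begin
    n × x          ≈⟨ ×-congʳ n (*-identityˡ x) ⟨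
    n × (1# * x)   ≈⟨ ×-assoc-* n 1# x ⟨
    (n × 1#) * x   ≈⟨ *-congʳ (fromℕ≈×1# n) ⟨
    fromℕ n * x    ∎

  ⁻¹-unique : ∀ {x y} → ¬ (x ≈ 0#) → x * y ≈ 1# → y ≈ x ⁻¹
  ⁻¹-unique {x} {y} x≉0 xy≈1 = begin
    y                ≈⟨ *-identityʳ y ⟨
    y * 1#           ≈⟨ *-congˡ (⁻¹-inverse x x≉0) ⟨
    y * (x * x ⁻¹)   ≈⟨ *-assoc y x _ ⟨
    (y * x) * x ⁻¹   ≈⟨ *-congʳ (trans (*-comm y x) xy≈1) ⟩
    1# * x ⁻¹        ≈⟨ *-identityˡ _ ⟩
    x ⁻¹             ∎

  *-cancelˡ-≈0 : ∀ {x y} → ¬ (x ≈ 0#) → x * y ≈ 0# → y ≈ 0#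
  *-cancelˡ-≈0 {x} {y} x≉0 xy≈0 = begin
    y                ≈⟨ *-identityˡ y ⟨
    1# * y           ≈⟨ *-congʳ (trans (*-comm _ x) (⁻¹-inverse x x≉0)) ⟨
    (x ⁻¹ * x) * y   ≈⟨ *-assoc _ _ _ ⟩
    x ⁻¹ * (x * y)   ≈⟨ *-congˡ xy≈0 ⟩
    x ⁻¹ * 0#        ≈⟨ zeroʳ _ ⟩
    0#               ∎

module FiniteSums {c ℓ : Level} (K : Field c ℓ) where
  open Field K
  open FieldTheory K using (Σ<)
  open CauchyProduct commutativeRing using (_⋆_; δ; δ-<; ⋆-snoc)
  open import Data.Nat.Properties using (≤-refl; m<n⇒m<1+n)
  open import Relation.Binary.Reasoning.Setoid setoid

  Σ<-cong : ∀ {f g} n → (∀ j → j < n → f j ≈ g j) → Σ< n f ≈ Σ< n g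
  Σ<-cong zero    _   = refl
  Σ<-cong (suc n) f≈g = +-cong (Σ<-cong n (λ j j<n → f≈g j (m<n⇒m<1+n j<n))) (f≈g n ≤-refl)

  Σ<-zero : ∀ {f} n → (∀ j → j < n → f j ≈ 0#) → Σ< n f ≈ 0#
  Σ<-zero zero    _   = refl
  Σ<-zero (suc n) f≈0 =
    trans (+-cong (Σ<-zero n (λ j j<n → f≈0 j (m<n⇒m<1+n j<n))) (f≈0 n ≤-refl)) (+-identityʳ 0#)

  Σ<-head : ∀ (f : ℕ → Carrier) n → Σ< (suc n) f ≈ f 0 + Σ< n (f ∘ suc)
  Σ<-head f zero    = +-comm 0# (f 0)
  Σ<-head f (suc n) = trans (+-congʳ (Σ<-head f n)) (+-assoc _ _ _)

  Σ<-δ : ∀ (h : ℕ → Carrier) n → Σ< (suc n) (λ m → h m * δ m n) ≈ h n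
  Σ<-δ h n = begin
    Σ< n (λ m → h m * δ m n) + h n * δ n n
      ≈⟨ +-cong (Σ<-zero n (λ m m<n → trans (*-congˡ (δ-< m<n)) (zeroʳ _))) (*-congˡ (δ-diag n)) ⟩
    0# + h n * 1#
      ≈⟨ trans (+-identityˡ _) (*-identityʳ _) ⟩
    h n ∎
    where
    δ-diag : ∀ n → δ n n ≈ 1#
    δ-diag zero    = refl
    δ-diag (suc n) = δ-diag n

  ⋆-as-Σ : ∀ (f g : ℕ → Carrier) n → (f ⋆ g) n ≈ Σ< (suc n) (λ s → f s * g (n ∸ s))
  ⋆-as-Σ f g zero    = sym (+-identityˡ _)
  ⋆-as-Σ f g (suc n) =
    trans (+-congˡ (⋆-as-Σ (f ∘ suc) g n)) (sym (Σ<-head (λ s → f s * g (suc n ∸ s)) (suc n)))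

  ⋆-as-Σ-reversed : ∀ (f g : ℕ → Carrier) n → (f ⋆ g) n ≈ Σ< (suc n) (λ j → f (n ∸ j) * g j)
  ⋆-as-Σ-reversed f g zero    = sym (+-identityˡ _)
  ⋆-as-Σ-reversed f g (suc n) = begin
    (f ⋆ g) (suc n)
      ≈⟨ ⋆-snoc f g n ⟩
    (f ⋆ (g ∘ suc)) n + f (suc n) * g 0
      ≈⟨ +-congʳ (⋆-as-Σ-reversed f (g ∘ suc) n) ⟩
    Σ< (suc n) (λ j → f (n ∸ j) * g (suc j)) + f (suc n) * g 0
      ≈⟨ +-comm _ _ ⟩
    f (suc n) * g 0 + Σ< (suc n) (λ j → f (n ∸ j) * g (suc j))
      ≈⟨ Σ<-head (λ j → f (suc n ∸ j) * g j) (suc n) ⟨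
    Σ< (suc (suc n)) (λ j → f (suc n ∸ j) * g j) ∎

module ExponentialSeries {c ℓ : Level} (K : Field c ℓ) where
  open Field K
  open FieldTheory K hiding (_^_)
  open CauchyProduct commutativeRing
  open FiniteSums K
  open FieldProperties K
  open import Algebra.Properties.Semiring.Mult semiring
    using (_×_; ×-congʳ; ×-comm-*; ×-assoc-*; ×-assocˡ)
  open import Algebra.Properties.Semiring.Exp semiring using (_^_; ^-congˡ)
  open import Algebra.Properties.CommutativeSemiring.Exp commutativeSemiring using (^-distrib-*)
  open import Algebra.Properties.CommutativeSemigroup *-commutativeSemigroup
    using () renaming (x∙yz≈y∙xz to x*yz≈y*xz)
  open import Algebra.Properties.Ring ring
    using (-1*x≈-x; -‿distribʳ-*; -‿involutive; +-inverseˡ-unique)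
  open import Data.Nat using (NonZero; _!)
  open import Data.Nat.Properties using (_!≢0; +-∸-assoc)
  open import Relation.Binary.PropositionalEquality as ≡ using ()
  open import Relation.Nullary using (¬_)
  open import Relation.Binary.Reasoning.Setoid setoid

  expCoeff : Carrier → ℕ → Carrier
  expCoeff x j = invFact j * x ^ j

  -- the coefficients of (e^{xT} - 1) / (xT)
  dexpCoeff : Carrier → ℕ → Carrier
  dexpCoeff x j = invFact (suc j) * x ^ j

  module _ (char0 : CharacteristicZero) where

    fromℕ-nonZero : ∀ n → .{{NonZero n}} → ¬ (fromℕ n ≈ 0#)
    fromℕ-nonZero (suc n) = char0 n

    ×-cancel : ∀ n {x} → suc n × x ≈ 0# → x ≈ 0#
    ×-cancel n {x} n×x≈0 = *-cancelˡ-≈0 (char0 n) (trans (sym (×≈fromℕ* (suc n) x)) n×x≈0)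

    invFact-zero : invFact 0 ≈ 1#
    invFact-zero = sym (⁻¹-unique (char0 0) (trans (*-identityʳ _) (+-identityʳ 1#)))

    ∂-invFact : ∂ invFact ≋ invFact
    ∂-invFact j = ⁻¹-unique (fromℕ-nonZero (j !) {{j !≢0}}) (begin
      fromℕ (j !) * (suc j × invFact (suc j))    ≈⟨ ×-comm-* (suc j) _ _ ⟩
      suc j × (fromℕ (j !) * invFact (suc j))    ≈⟨ ×-assoc-* (suc j) _ _ ⟨
      (suc j × fromℕ (j !)) * invFact (suc j)    ≈⟨ *-congʳ (×-congʳ (suc j) (fromℕ≈×1# (j !))) ⟩
      (suc j × ((j !) × 1#)) * invFact (suc j)   ≈⟨ *-congʳ (×-assocˡ 1# (suc j) (j !)) ⟩
      ((suc j !) × 1#) * invFact (suc j)         ≈⟨ *-congʳ (fromℕ≈×1# (suc j !)) ⟨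
      fromℕ (suc j !) * invFact (suc j)
        ≈⟨ ⁻¹-inverse _ (fromℕ-nonZero (suc j !) {{suc j !≢0}}) ⟩
      1# ∎)

    ∂-expCoeff : ∀ x → ∂ (expCoeff x) ≋ (λ j → x * expCoeff x j)
    ∂-expCoeff x j = begin
      suc j × (invFact (suc j) * (x * x ^ j))   ≈⟨ ×-assoc-* (suc j) _ _ ⟨
      (suc j × invFact (suc j)) * (x * x ^ j)   ≈⟨ *-congʳ (∂-invFact j) ⟩
      invFact j * (x * x ^ j)                   ≈⟨ x*yz≈y*xz _ _ _ ⟩
      x * (invFact j * x ^ j)                   ∎

    expCoeff-zero : ∀ x → expCoeff x 0 ≈ 1#
    expCoeff-zero x = trans (*-identityʳ _) invFact-zero

    expCoeff-one : ∀ x → expCoeff x 1 ≈ x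
    expCoeff-one x = trans (*-cong invFact-zero (*-identityʳ x)) (*-identityˡ x)

    dexpCoeff-≈0 : ∀ {x} → x ≈ 0# → dexpCoeff x ≋ δ 0
    dexpCoeff-≈0 x≈0 zero    = trans (*-identityʳ _) invFact-zero
    dexpCoeff-≈0 x≈0 (suc j) = trans (*-congˡ (trans (*-congʳ x≈0) (zeroˡ _))) (zeroʳ _)

    expCoeff-neg1⋆invFact : expCoeff (- 1#) ⋆ invFact ≋ δ 0
    expCoeff-neg1⋆invFact zero    =
      trans (*-cong (expCoeff-zero (- 1#)) invFact-zero) (*-identityˡ 1#)
    expCoeff-neg1⋆invFact (suc n) = ×-cancel n (begin
      ∂ (E⁻ ⋆ invFact) n
        ≈⟨ ∂-⋆ E⁻ invFact n ⟩
      (∂ E⁻ ⋆ invFact) n + (E⁻ ⋆ ∂ invFact) n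
        ≈⟨ +-cong (⋆-cong ∂E⁻≋-E⁻ (λ _ → refl) n) (⋆-cong (λ _ → refl) ∂-invFact n) ⟩
      ((λ j → - E⁻ j) ⋆ invFact) n + (E⁻ ⋆ invFact) n
        ≈⟨ ⋆-distribʳ (λ j → - E⁻ j) E⁻ invFact n ⟨
      ((λ j → - E⁻ j + E⁻ j) ⋆ invFact) n
        ≈⟨ ⋆-zeroˡ invFact (λ j → -‿inverseˡ (E⁻ j)) n ⟩
      0# ∎)
      where
      E⁻ : ℕ → Carrier
      E⁻ = expCoeff (- 1#)
      ∂E⁻≋-E⁻ : ∂ E⁻ ≋ (λ j → - E⁻ j)
      ∂E⁻≋-E⁻ j = trans (∂-expCoeff (- 1#) j) (-1*x≈-x (E⁻ j))

    expCoeff-neg1⋆invFact∘suc : expCoeff (- 1#) ⋆ (invFact ∘ suc) ≋ dexpCoeff (- 1#)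
    expCoeff-neg1⋆invFact∘suc n = begin
      (E⁻ ⋆ (invFact ∘ suc)) n
        ≈⟨ +-inverseˡ-unique _ _
             (trans (sym (⋆-snoc E⁻ invFact n)) (expCoeff-neg1⋆invFact (suc n))) ⟩
      - (E⁻ (suc n) * invFact 0)
        ≈⟨ -‿cong (trans (*-congˡ invFact-zero) (*-identityʳ _)) ⟩
      - (invFact (suc n) * (- 1# * (- 1#) ^ n))
        ≈⟨ -‿cong (*-congˡ (-1*x≈-x _)) ⟩
      - (invFact (suc n) * - (- 1#) ^ n)
        ≈⟨ -‿cong (-‿distribʳ-* _ _) ⟨
      - - (invFact (suc n) * (- 1#) ^ n)
        ≈⟨ -‿involutive _ ⟩
      dexpCoeff (- 1#) n ∎
      where
      E⁻ : ℕ → Carrier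
      E⁻ = expCoeff (- 1#)

    expCoeff-neg⋆dexpCoeff : ∀ a → expCoeff (- a) ⋆ dexpCoeff a ≋ dexpCoeff (- a)
    expCoeff-neg⋆dexpCoeff a n = begin
      (expCoeff (- a) ⋆ dexpCoeff a) n
        ≈⟨ ⋆-cong (λ j → trans (*-congˡ (-a^≈ j)) (sym (*-assoc _ _ _))) (λ _ → refl) n ⟩
      ((λ j → expCoeff (- 1#) j * a ^ j) ⋆ (λ j → invFact (suc j) * a ^ j)) n
        ≈⟨ ⋆-rescale a (expCoeff (- 1#)) (invFact ∘ suc) n ⟩
      (expCoeff (- 1#) ⋆ (invFact ∘ suc)) n * a ^ n
        ≈⟨ *-congʳ (expCoeff-neg1⋆invFact∘suc n) ⟩
      (invFact (suc n) * (- 1#) ^ n) * a ^ n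
        ≈⟨ trans (*-congˡ (-a^≈ n)) (sym (*-assoc _ _ _)) ⟨
      dexpCoeff (- a) n ∎
      where
      -a^≈ : ∀ j → (- a) ^ j ≈ (- 1#) ^ j * a ^ j
      -a^≈ j = trans (^-congˡ j (sym (-1*x≈-x a))) (^-distrib-* (- 1#) a j)

    bernoulli⋆dexpCoeff : ∀ {B} → IsBernoulli B → ∀ y →
      (λ s → (B s * invFact s) * y ^ s) ⋆ dexpCoeff y ≋ δ 0
    bernoulli⋆dexpCoeff {B} isB y m = begin
      ((λ s → β s * y ^ s) ⋆ dexpCoeff y) m
        ≈⟨ ⋆-rescale y β (invFact ∘ suc) m ⟩
      (β ⋆ (invFact ∘ suc)) m * y ^ m
        ≈⟨ *-congʳ (⋆-as-Σ β (invFact ∘ suc) m) ⟩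
      Σ< (suc m) (λ s → β s * invFact (suc (m ∸ s))) * y ^ m
        ≈⟨ *-congʳ (Σ<-cong (suc m) (λ { s (s≤s s≤m) → *-congˡ (invFact-suc-∸ s≤m) })) ⟨
      Σ< (suc m) (λ s → β s * invFact (suc m ∸ s)) * y ^ m
        ≈⟨ *-congʳ (isB (suc m)) ⟩
      delta1 (suc m) * y ^ m
        ≈⟨ delta1-suc m ⟩
      δ 0 m ∎
      where
      β : ℕ → Carrier
      β s = B s * invFact s
      invFact-suc-∸ : ∀ {s} → s ≤ m → invFact (suc m ∸ s) ≈ invFact (suc (m ∸ s))
      invFact-suc-∸ s≤m = reflexive (≡.cong invFact (+-∸-assoc 1 s≤m))
      delta1-suc : ∀ m → delta1 (suc m) * y ^ m ≈ δ 0 m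
      delta1-suc zero    = *-identityˡ 1#
      delta1-suc (suc m) = zeroˡ _

module WordCoefficients {c ℓ : Level} (K : Field c ℓ) where
  open Field K
  open FieldTheory K hiding (_^_)
  open CauchyProduct commutativeRing
  open FiniteSums K
  open ExponentialSeries K using (expCoeff; dexpCoeff)
  open import Algebra.Properties.Semiring.Exp semiring using (_^_)
  open import Algebra.Properties.Ring ring using (-0#≈0#)
  open import Data.Bool using (true; false)
  open import Data.List using ([]; _∷_; _∷ʳ_; length; replicate)
  open import Data.List.Properties using (length-replicate; map-∘)
  open import Relation.Binary.PropositionalEquality as ≡ using (_≡_)
  open import Relation.Binary.Reasoning.Setoid setoid

  Xⁿ : ℕ → Word
  Xⁿ n = replicate n false

  XⁿY : ℕ → Word
  XⁿY n = Xⁿ n ∷ʳ true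

  length-XⁿY : ∀ n → length (XⁿY n) ≡ suc n
  length-XⁿY zero    = ≡.refl
  length-XⁿY (suc n) = ≡.cong suc (length-XⁿY n)

  countY-XⁿY : ∀ n → countY (XⁿY n) ≤ 1
  countY-XⁿY zero    = s≤s z≤n
  countY-XⁿY (suc n) = countY-XⁿY n

  coeffX : Series → ℕ → Carrier
  coeffX f = f ∘ Xⁿ

  coeffXY : Series → ℕ → Carrier
  coeffXY f = f ∘ XⁿY

  *S-∷ : ∀ f g a w → (f *S g) (a ∷ w) ≡ f [] * g (a ∷ w) + ((f ∘ (a ∷_)) *S g) w
  *S-∷ f g a w = ≡.cong (λ xs → f [] * g (a ∷ w) + sumList xs) (≡.sym (map-∘ (splits w)))

  coeffX-*S : ∀ f g → coeffX (f *S g) ≋ coeffX f ⋆ coeffX g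
  coeffX-*S f g zero    = +-identityʳ _
  coeffX-*S f g (suc n) =
    trans (reflexive (*S-∷ f g false (Xⁿ n))) (+-congˡ (coeffX-*S (f ∘ (false ∷_)) g n))

  -- Y is the last letter of XⁿY, so it lies in the right factor unless that factor is empty
  coeffXY-*S : ∀ f g n → coeffXY (f *S g) n ≈ (coeffX f ⋆ coeffXY g) n + coeffXY f n * g []
  coeffXY-*S f g zero    = +-congˡ (+-identityʳ _)
  coeffXY-*S f g (suc n) =
    trans (reflexive (*S-∷ f g false (XⁿY n)))
          (trans (+-congˡ (coeffXY-*S (f ∘ (false ∷_)) g n)) (sym (+-assoc _ _ _)))

  coeffX-oneS : coeffX oneS ≋ δ 0
  coeffX-oneS zero    = refl
  coeffX-oneS (suc n) = refl

  coeffXY-oneS : coeffXY oneS ≋ const 0#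
  coeffXY-oneS zero    = refl
  coeffXY-oneS (suc n) = refl

  coeffX-Xs : coeffX Xs ≋ δ 1
  coeffX-Xs zero          = refl
  coeffX-Xs (suc zero)    = refl
  coeffX-Xs (suc (suc n)) = refl

  coeffXY-Xs : coeffXY Xs ≋ const 0#
  coeffXY-Xs zero          = refl
  coeffXY-Xs (suc zero)    = refl
  coeffXY-Xs (suc (suc n)) = refl

  coeffX-Ys : coeffX Ys ≋ const 0#
  coeffX-Ys zero    = refl
  coeffX-Ys (suc n) = refl

  coeffXY-Ys : coeffXY Ys ≋ δ 0
  coeffXY-Ys zero    = refl
  coeffXY-Ys (suc n) = refl

  coeffX-adX : ∀ f → coeffX f ≋ const 0# → coeffX (adX f) ≋ const 0#
  coeffX-adX f f≋0 n =
    trans (+-cong (trans (coeffX-*S Xs f n) (⋆-zeroʳ (coeffX Xs) f≋0 n))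
                  (-‿cong (trans (coeffX-*S f Xs n) (⋆-zeroˡ (coeffX Xs) f≋0 n))))
          (-‿inverseʳ 0#)

  coeffXY-adX : ∀ f → coeffXY (adX f) ≋ δ 1 ⋆ coeffXY f
  coeffXY-adX f n = begin
    coeffXY (Xs *S f) n - coeffXY (f *S Xs) n
      ≈⟨ +-cong (coeffXY-*S Xs f n) (-‿cong (coeffXY-*S f Xs n)) ⟩
    ((coeffX Xs ⋆ coeffXY f) n + coeffXY Xs n * f [])
      - ((coeffX f ⋆ coeffXY Xs) n + coeffXY f n * 0#)
      ≈⟨ +-cong (+-cong (⋆-cong coeffX-Xs (λ _ → refl) n)
                        (trans (*-congʳ (coeffXY-Xs n)) (zeroˡ _)))
                (-‿cong (+-cong (⋆-zeroʳ (coeffX f) coeffXY-Xs n) (zeroʳ _))) ⟩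
    ((δ 1 ⋆ coeffXY f) n + 0#) - (0# + 0#)
      ≈⟨ +-cong (+-identityʳ _) (trans (-‿cong (+-identityʳ 0#)) -0#≈0#) ⟩
    (δ 1 ⋆ coeffXY f) n + 0#
      ≈⟨ +-identityʳ _ ⟩
    (δ 1 ⋆ coeffXY f) n ∎

  coeffX-adX^Y : ∀ k → coeffX (adX^ k Ys) ≋ const 0#
  coeffX-adX^Y zero    = coeffX-Ys
  coeffX-adX^Y (suc k) = coeffX-adX (adX^ k Ys) (coeffX-adX^Y k)

  coeffXY-adX^Y : ∀ k → coeffXY (adX^ k Ys) ≋ δ k
  coeffXY-adX^Y zero            = coeffXY-Ys
  coeffXY-adX^Y (suc k) zero    = trans (coeffXY-adX (adX^ k Ys) 0) (zeroˡ _)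
  coeffXY-adX^Y (suc k) (suc n) =
    trans (coeffXY-adX (adX^ k Ys) (suc n))
          (trans (δ-⋆ (coeffXY (adX^ k Ys)) {n = suc n} (s≤s z≤n)) (coeffXY-adX^Y k n))

  coeffX-genSeries : ∀ a e → coeffX (genSeries a e) ≋ (λ j → a * δ 1 j)
  coeffX-genSeries a e j =
    trans (+-cong (*-congˡ (coeffX-Xs j))
                  (Σ<-zero (length (Xⁿ j)) (λ k _ → trans (*-congˡ (coeffX-adX^Y k j)) (zeroʳ _))))
          (+-identityʳ _)

  coeffXY-genSeries : ∀ a e → coeffXY (genSeries a e) ≋ e ∘ suc
  coeffXY-genSeries a e n = begin
    a * coeffXY Xs n + Σ< (length (XⁿY n)) (λ k → e (suc k) * adX^ k Ys (XⁿY n))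
      ≈⟨ +-cong (trans (*-congˡ (coeffXY-Xs n)) (zeroʳ a))
                (reflexive (≡.cong (λ L → Σ< L (λ k → e (suc k) * adX^ k Ys (XⁿY n)))
                                   (length-XⁿY n))) ⟩
    0# + Σ< (suc n) (λ k → e (suc k) * coeffXY (adX^ k Ys) n)
      ≈⟨ +-identityˡ _ ⟩
    Σ< (suc n) (λ k → e (suc k) * coeffXY (adX^ k Ys) n)
      ≈⟨ Σ<-cong (suc n) (λ k _ → *-congˡ (coeffXY-adX^Y k n)) ⟩
    Σ< (suc n) (λ k → e (suc k) * δ k n)
      ≈⟨ Σ<-δ (e ∘ suc) n ⟩
    e (suc n) ∎

  module _ (f : Series) {x : Carrier} (coeffX-f : coeffX f ≋ (λ j → x * δ 1 j)) where

    coeffX-powS : ∀ m → coeffX (powS f m) ≋ (λ n → x ^ m * δ m n)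
    coeffX-powS zero    n       = trans (coeffX-oneS n) (sym (*-identityˡ _))
    coeffX-powS (suc m) zero    = begin
      coeffX (f *S powS f m) 0   ≈⟨ coeffX-*S f (powS f m) 0 ⟩
      f [] * powS f m []         ≈⟨ *-congʳ (trans (coeffX-f 0) (zeroʳ x)) ⟩
      0# * powS f m []           ≈⟨ zeroˡ _ ⟩
      0#                         ≈⟨ zeroʳ _ ⟨
      x ^ suc m * δ (suc m) 0    ∎
    coeffX-powS (suc m) (suc n) = begin
      coeffX (f *S powS f m) (suc n)
        ≈⟨ coeffX-*S f (powS f m) (suc n) ⟩
      (coeffX f ⋆ coeffX (powS f m)) (suc n)
        ≈⟨ ⋆-cong coeffX-f (coeffX-powS m) (suc n) ⟩
      ((λ j → x * δ 1 j) ⋆ xᵐδₘ) (suc n)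
        ≈⟨ ⋆-scaleˡ x (δ 1) xᵐδₘ (suc n) ⟩
      x * (δ 1 ⋆ xᵐδₘ) (suc n)
        ≈⟨ *-congˡ (δ-⋆ xᵐδₘ {n = suc n} (s≤s z≤n)) ⟩
      x * (x ^ m * δ m n)
        ≈⟨ *-assoc _ _ _ ⟨
      x ^ suc m * δ (suc m) (suc n) ∎
      where
      xᵐδₘ : ℕ → Carrier
      xᵐδₘ j = x ^ m * δ m j

    coeffXY-powS : ∀ m → coeffXY (powS f (suc m)) ≋ coeffX (powS f m) ⋆ coeffXY f
    coeffXY-powS zero    n = begin
      coeffXY (f *S oneS) n
        ≈⟨ coeffXY-*S f oneS n ⟩
      (coeffX f ⋆ coeffXY oneS) n + coeffXY f n * 1#
        ≈⟨ +-cong (⋆-zeroʳ (coeffX f) coeffXY-oneS n) (*-identityʳ _) ⟩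
      0# + coeffXY f n
        ≈⟨ +-identityˡ _ ⟩
      coeffXY f n
        ≈⟨ δ-⋆ (coeffXY f) z≤n ⟨
      (δ 0 ⋆ coeffXY f) n
        ≈⟨ ⋆-cong coeffX-oneS (λ _ → refl) n ⟨
      (coeffX oneS ⋆ coeffXY f) n ∎
    coeffXY-powS (suc m) n = begin
      coeffXY (f *S fᵐ⁺¹) n
        ≈⟨ coeffXY-*S f fᵐ⁺¹ n ⟩
      (coeffX f ⋆ coeffXY fᵐ⁺¹) n + coeffXY f n * fᵐ⁺¹ []
        ≈⟨ +-cong (⋆-cong (λ _ → refl) (coeffXY-powS m) n) (*-congˡ fᵐ⁺¹[]≈0) ⟩
      (coeffX f ⋆ (coeffX (powS f m) ⋆ coeffXY f)) n + coeffXY f n * 0#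
        ≈⟨ +-cong (⋆-assoc (coeffX f) (coeffX (powS f m)) (coeffXY f) n) (zeroʳ _) ⟩
      ((coeffX f ⋆ coeffX (powS f m)) ⋆ coeffXY f) n + 0#
        ≈⟨ +-identityʳ _ ⟩
      ((coeffX f ⋆ coeffX (powS f m)) ⋆ coeffXY f) n
        ≈⟨ ⋆-cong (coeffX-*S f (powS f m)) (λ _ → refl) n ⟨
      (coeffX fᵐ⁺¹ ⋆ coeffXY f) n ∎
      where
      fᵐ⁺¹ : Series
      fᵐ⁺¹ = powS f (suc m)
      fᵐ⁺¹[]≈0 : fᵐ⁺¹ [] ≈ 0#
      fᵐ⁺¹[]≈0 = trans (coeffX-powS (suc m) 0) (zeroʳ _)

    coeffX-expS : coeffX (expS f) ≋ expCoeff x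
    coeffX-expS n = begin
      Σ< (suc (length (Xⁿ n))) (λ m → invFact m * powS f m (Xⁿ n))
        ≈⟨ reflexive (≡.cong (λ L → Σ< (suc L) (λ m → invFact m * coeffX (powS f m) n))
                             (length-replicate n)) ⟩
      Σ< (suc n) (λ m → invFact m * coeffX (powS f m) n)
        ≈⟨ Σ<-cong (suc n) (λ m _ → trans (*-congˡ (coeffX-powS m n)) (sym (*-assoc _ _ _))) ⟩
      Σ< (suc n) (λ m → expCoeff x m * δ m n)
        ≈⟨ Σ<-δ (expCoeff x) n ⟩
      expCoeff x n ∎

    coeffXY-expS : coeffXY (expS f) ≋ dexpCoeff x ⋆ coeffXY f
    coeffXY-expS n = begin
      Σ< (suc (length (XⁿY n))) (λ m → invFact m * powS f m (XⁿY n))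
        ≈⟨ reflexive (≡.cong (λ L → Σ< (suc L) (λ m → invFact m * coeffXY (powS f m) n))
                             (length-XⁿY n)) ⟩
      Σ< (suc (suc n)) (λ m → invFact m * coeffXY (powS f m) n)
        ≈⟨ Σ<-head _ (suc n) ⟩
      invFact 0 * coeffXY oneS n + Σ< (suc n) (λ m → invFact (suc m) * coeffXY (powS f (suc m)) n)
        ≈⟨ trans (+-congʳ (trans (*-congˡ (coeffXY-oneS n)) (zeroʳ _))) (+-identityˡ _) ⟩
      Σ< (suc n) (λ m → invFact (suc m) * coeffXY (powS f (suc m)) n)
        ≈⟨ Σ<-cong (suc n) (λ { m (s≤s m≤n) → term m≤n }) ⟩
      Σ< (suc n) (λ m → dexpCoeff x m * coeffXY f (n ∸ m))
        ≈⟨ ⋆-as-Σ (dexpCoeff x) (coeffXY f) n ⟨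
      (dexpCoeff x ⋆ coeffXY f) n ∎
      where
      term : ∀ {m} → m ≤ n →
        invFact (suc m) * coeffXY (powS f (suc m)) n ≈ dexpCoeff x m * coeffXY f (n ∸ m)
      term {m} m≤n = begin
        invFact (suc m) * coeffXY (powS f (suc m)) n
          ≈⟨ *-congˡ (coeffXY-powS m n) ⟩
        invFact (suc m) * (coeffX (powS f m) ⋆ coeffXY f) n
          ≈⟨ *-congˡ (⋆-cong (coeffX-powS m) (λ _ → refl) n) ⟩
        invFact (suc m) * ((λ j → x ^ m * δ m j) ⋆ coeffXY f) n
          ≈⟨ *-congˡ (⋆-scaleˡ (x ^ m) (δ m) (coeffXY f) n) ⟩
        invFact (suc m) * (x ^ m * (δ m ⋆ coeffXY f) n)
          ≈⟨ *-congˡ (*-congˡ (δ-⋆ (coeffXY f) m≤n)) ⟩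
        invFact (suc m) * (x ^ m * coeffXY f (n ∸ m))
          ≈⟨ *-assoc _ _ _ ⟨
        dexpCoeff x m * coeffXY f (n ∸ m) ∎

  coeffX-expS-genSeries : ∀ a e → coeffX (expS (genSeries a e)) ≋ expCoeff a
  coeffX-expS-genSeries a e = coeffX-expS (genSeries a e) (coeffX-genSeries a e)

  coeffXY-expS-genSeries : ∀ a e → coeffXY (expS (genSeries a e)) ≋ dexpCoeff a ⋆ (e ∘ suc)
  coeffXY-expS-genSeries a e n =
    trans (coeffXY-expS (genSeries a e) (coeffX-genSeries a e) n)
          (⋆-cong (λ _ → refl) (coeffXY-genSeries a e) n)

  coeffX-expS-·S-Xs : ∀ a → coeffX (expS (a ·S Xs)) ≋ expCoeff a
  coeffX-expS-·S-Xs a = coeffX-expS (a ·S Xs) (λ j → *-congˡ (coeffX-Xs j))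

  coeffXY-expS-·S-Xs : ∀ a → coeffXY (expS (a ·S Xs)) ≋ const 0#
  coeffXY-expS-·S-Xs a n =
    trans (coeffXY-expS (a ·S Xs) (λ j → *-congˡ (coeffX-Xs j)) n)
          (⋆-zeroʳ (dexpCoeff a) (λ j → trans (*-congˡ (coeffXY-Xs j)) (zeroʳ a)) n)

module CoefficientComparison {c ℓ : Level} (K : Field c ℓ) where
  open Field K
  open FieldTheory K
  open CauchyProduct commutativeRing
  open FiniteSums K
  open ExponentialSeries K
  open WordCoefficients K
  open import Algebra.Properties.Semiring.Exp semiring using () renaming (_^_ to _^ᴿ_)
  open import Data.List using ([])
  open import Data.Nat.Properties using (+-∸-assoc)
  open import Relation.Binary.PropositionalEquality as ≡ using ()
  open import Relation.Binary.Reasoning.Setoid setoid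

  ^≈^ᴿ : ∀ x n → x ^ n ≈ x ^ᴿ n
  ^≈^ᴿ x zero    = refl
  ^≈^ᴿ x (suc n) = *-congˡ (^≈^ᴿ x n)

  module _ (char0 : CharacteristicZero) (b u : ℕ → Carrier)
    (H : (expS ((- u 0) ·S Xs) *S expS (genSeries (u 0) u)) ≡S expS (genSeries (b 0) b) modIY)
    where

    private
      α : Carrier
      α = - u 0
      E G G′ : Series
      E  = expS (α ·S Xs)
      G  = expS (genSeries (u 0) u)
      G′ = expS (genSeries (b 0) b)

    b₀≈0 : b 0 ≈ 0#
    b₀≈0 = begin
      b 0                              ≈⟨ expCoeff-one char0 (b 0) ⟨
      expCoeff (b 0) 1                 ≈⟨ coeffX-expS-genSeries (b 0) b 1 ⟨
      coeffX G′ 1                      ≈⟨ H (Xⁿ 1) z≤n ⟨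
      coeffX (E *S G) 1                ≈⟨ coeffX-*S E G 1 ⟩
      (coeffX E ⋆ coeffX G) 1
        ≈⟨ ⋆-cong (coeffX-expS-·S-Xs α) (coeffX-expS-genSeries (u 0) u) 1 ⟩
      (expCoeff α ⋆ expCoeff (u 0)) 1
        ≈⟨ +-cong (*-cong (expCoeff-zero char0 α) (expCoeff-one char0 (u 0)))
                  (*-cong (expCoeff-one char0 α) (expCoeff-zero char0 (u 0))) ⟩
      1# * u 0 + α * 1#                ≈⟨ +-cong (*-identityˡ _) (*-identityʳ _) ⟩
      u 0 - u 0                        ≈⟨ -‿inverseʳ _ ⟩
      0#                               ∎

    b∘suc≋dexpCoeff⋆u∘suc : b ∘ suc ≋ dexpCoeff α ⋆ (u ∘ suc)
    b∘suc≋dexpCoeff⋆u∘suc n = begin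
      b (suc n)                                        ≈⟨ δ-⋆ (b ∘ suc) z≤n ⟨
      (δ 0 ⋆ (b ∘ suc)) n
        ≈⟨ ⋆-cong (dexpCoeff-≈0 char0 b₀≈0) (λ _ → refl) n ⟨
      (dexpCoeff (b 0) ⋆ (b ∘ suc)) n                  ≈⟨ coeffXY-expS-genSeries (b 0) b n ⟨
      coeffXY G′ n                                     ≈⟨ H (XⁿY n) (countY-XⁿY n) ⟨
      coeffXY (E *S G) n                               ≈⟨ coeffXY-*S E G n ⟩
      (coeffX E ⋆ coeffXY G) n + coeffXY E n * G []
        ≈⟨ +-congˡ (trans (*-congʳ (coeffXY-expS-·S-Xs α n)) (zeroˡ _)) ⟩
      (coeffX E ⋆ coeffXY G) n + 0#                    ≈⟨ +-identityʳ _ ⟩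
      (coeffX E ⋆ coeffXY G) n
        ≈⟨ ⋆-cong (coeffX-expS-·S-Xs α) (coeffXY-expS-genSeries (u 0) u) n ⟩
      (expCoeff α ⋆ (dexpCoeff (u 0) ⋆ (u ∘ suc))) n   ≈⟨ ⋆-assoc _ _ _ n ⟩
      ((expCoeff α ⋆ dexpCoeff (u 0)) ⋆ (u ∘ suc)) n
        ≈⟨ ⋆-cong (expCoeff-neg⋆dexpCoeff char0 (u 0)) (λ _ → refl) n ⟩
      (dexpCoeff α ⋆ (u ∘ suc)) n                      ∎

    b-formula : ∀ n →
      b (suc n) ≈ Σ[ 1 ⋯ suc n ] (λ i → ((α ^ (suc n ∸ i)) * invFact (suc (suc n) ∸ i)) * u i)
    b-formula n = begin
      b (suc n)
        ≈⟨ b∘suc≋dexpCoeff⋆u∘suc n ⟩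
      (dexpCoeff α ⋆ (u ∘ suc)) n
        ≈⟨ ⋆-as-Σ-reversed (dexpCoeff α) (u ∘ suc) n ⟩
      Σ< (suc n) (λ j → dexpCoeff α (n ∸ j) * u (suc j))
        ≈⟨ Σ<-cong (suc n) (λ { j (s≤s j≤n) → *-congʳ (term j≤n) }) ⟩
      Σ< (suc n) (λ j → ((α ^ (n ∸ j)) * invFact (suc n ∸ j)) * u (suc j)) ∎
      where
      term : ∀ {j} → j ≤ n → dexpCoeff α (n ∸ j) ≈ α ^ (n ∸ j) * invFact (suc n ∸ j)
      term {j} j≤n = trans (*-comm _ _)
        (*-cong (sym (^≈^ᴿ α (n ∸ j))) (reflexive (≡.cong invFact (≡.sym (+-∸-assoc 1 j≤n)))))

    u-formula : ∀ {B} → IsBernoulli B → ∀ n →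
      u (suc n) ≈ Σ< (suc n) (λ s → ((B s * invFact s) * (α ^ s)) * b (suc n ∸ s))
    u-formula {B} isB n = sym (begin
      Σ< (suc n) (λ s → ((B s * invFact s) * (α ^ s)) * b (suc n ∸ s))
        ≈⟨ Σ<-cong (suc n) (λ { s (s≤s s≤n) → *-cong (*-congˡ (^≈^ᴿ α s)) (b-suc-∸ s≤n) }) ⟩
      Σ< (suc n) (λ s → β s * b (suc (n ∸ s)))
        ≈⟨ ⋆-as-Σ β (b ∘ suc) n ⟨
      (β ⋆ (b ∘ suc)) n
        ≈⟨ ⋆-cong (λ _ → refl) b∘suc≋dexpCoeff⋆u∘suc n ⟩
      (β ⋆ (dexpCoeff α ⋆ (u ∘ suc))) n
        ≈⟨ ⋆-assoc β (dexpCoeff α) (u ∘ suc) n ⟩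
      ((β ⋆ dexpCoeff α) ⋆ (u ∘ suc)) n
        ≈⟨ ⋆-cong (bernoulli⋆dexpCoeff char0 isB α) (λ _ → refl) n ⟩
      (δ 0 ⋆ (u ∘ suc)) n
        ≈⟨ δ-⋆ (u ∘ suc) z≤n ⟩
      u (suc n) ∎)
      where
      β : ℕ → Carrier
      β s = (B s * invFact s) * α ^ᴿ s
      b-suc-∸ : ∀ {s} → s ≤ n → b (suc n ∸ s) ≈ b (suc (n ∸ s))
      b-suc-∸ s≤n = reflexive (≡.cong b (+-∸-assoc 1 s≤n))

open import Data.Product using (_×_; _,_)

lemma4p3 : ∀ {c ℓ : Level} (K : Field c ℓ) →
    let open Field K in
    let open FieldTheory K in
    CharacteristicZero →
    (B : ℕ → Carrier) → IsBernoulli B →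
    (b u : ℕ → Carrier) →
    ((expS ((- u 0) ·S Xs) *S expS (genSeries (u 0) u)) ≡S expS (genSeries (b 0) b) modIY) →
    (b 0 ≈ 0#)
    × (∀ k → 1 ≤ k →
         (b k ≈ Σ[ 1 ⋯ k ] (λ i → (((- u 0) ^ (k ∸ i)) * invFact (suc k ∸ i)) * u i))
         × (u k ≈ Σ< k (λ s → ((B s * invFact s) * ((- u 0) ^ s)) * b (k ∸ s))))
lemma4p3 K char0 B isB b u H =
  b₀≈0 char0 b u H , λ { (suc n) _ → b-formula char0 b u H n , u-formula char0 b u H isB n }
  where open CoefficientComparison K
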